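{- Let $m,n\geq 0$, let $s\in[m]$ and $t\in[n]$, and let $\mathbf{x}^{(s)}$ be any subword of $\mathbf{x}=x_1\cdots x_m$ of length $s$ and $\mathbf{y}^{(t)}$ any subword of $\mathbf{y}=y_1\cdots y_n$ of length $t$. Let $\tilde W=\{\mathbf{u}\in\mathsf{Shuf}(m,n): \mathbf{u}_{\mathbf{x}}=\mathbf{x}^{(s)}\text{ and }\mathbf{u}_{\mathbf{y}}=\mathbf{y}^{(t)}\}$. Then the induced subposet $(\tilde W,\leq_{\mathsf{bub}})$ of $\mathbf{Bub}(m,n)$ is a distributive lattice with $\binom{s+t}{s}$ elements.
   Context: Disjoint alphabets $X=\{x_1,\dots,x_m\}$, $Y=\{y_1,\dots,y_n\}$; $\mathbf{x}=x_1\cdots x_m$, $\mathbf{y}=y_1\cdots y_n$. A word is simple if it has no repeated letter; a subword of $w_1\cdots w_k$ is $w_{i_1}\cdots w_{i_l}$ with $i_1<\dots<i_l$. For simple words $\mathbf{u},\mathbf{v}$, $\mathbf{u}_{\mathbf{v}}$ is the subword of $\mathbf{u}$ formed by letters occurring in both. $\mathsf{Shuf}(m,n)$ is the set of simple words $\mathbf{u}$ over $X\cup Y$ with $\mathbf{u}_{\mathbf{x}}$ a subword of $\mathbf{x}$ and $\mathbf{u}_{\mathbf{y}}$ a subword of $\mathbf{y}$. For $\mathbf{u}=u_1\cdots u_k$, $\mathbf{u}_{\hat\imath}$ is $\mathbf{u}$ with $u_i$ deleted. Indels: $\mathbf{u}\to\mathbf{u}_{\hat\imath}$ if $u_i\in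 X$, and $\mathbf{u}_{\hat\imath}\to\mathbf{u}$ if $u_i\in Y$. Transpositions: $\mathbf{u}\Rightarrow\mathbf{u}'$ where $u_i\in X$, $u_{i+1}\in Y$ and $\mathbf{u}'$ swaps them. The bubble order $\leq_{\mathsf{bub}}$ is the reflexive transitive closure of indels and transpositions; $\mathbf{Bub}(m,n)=(\mathsf{Shuf}(m,n),\leq_{\mathsf{bub}})$. -}

module Defs where

open import Data.Nat using (ℕ; _≤_; _+_)
open import Data.Nat.Combinatorics using (_C_)
open import Data.Fin using (Fin)
import Data.Fin.Properties as FinP
open import Data.Sum using (_⊎_; inj₁; inj₂)
import Data.Sum.Properties as SumP
open import Data.List using (List; []; _∷_; _++_; map; filter; length; allFin)
open import Data.List.Relation.Unary.Unique.Propositional using (Unique)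
open import Data.List.Relation.Binary.Sublist.Propositional using (_⊆_)
open import Data.Product using (Σ; _×_; _,_; proj₁; ∃)
open import Relation.Binary.PropositionalEquality using (_≡_)
open import Relation.Binary.Definitions using (DecidableEquality)
open import Relation.Binary.Construct.Closure.ReflexiveTransitive using (Star)
open import Relation.Binary.Lattice.Structures using (IsDistributiveLattice)
open import Function.Bundles using (_⇔_)

-- Letters: x_i is inj₁ i (i : Fin m), y_j is inj₂ j (j : Fin n).
Letter : ℕ → ℕ → Set
Letter m n = Fin m ⊎ Fin n

Word : ℕ → ℕ → Set
Word m n = List (Letter m n)

_≟L_ : ∀ {m n} → DecidableEquality (Letter m n)
_≟L_ = SumP.≡-dec FinP._≟_ FinP._≟_

module _ {m n : ℕ} where
  open import Data.List.Membership.DecPropositional (_≟L_ {m} {n}) using (_∈?_)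

  restrict : Word m n → Word m n → Word m n
  restrict u v = filter (_∈? v) u

xWord : (m n : ℕ) → Word m n
xWord m n = map inj₁ (allFin m)

yWord : (m n : ℕ) → Word m n
yWord m n = map inj₂ (allFin n)

Simple : ∀ {m n} → Word m n → Set
Simple u = Unique u

IsShuf : (m n : ℕ) → Word m n → Set
IsShuf m n u = Simple u × (restrict u (xWord m n) ⊆ xWord m n) × (restrict u (yWord m n) ⊆ yWord m n)

data Move {m n : ℕ} : Word m n → Word m n → Set where
  delX : (p q : Word m n) (a : Fin m) → Move (p ++ inj₁ a ∷ q) (p ++ q)
  insY : (p q : Word m n) (b : Fin n) → Move (p ++ q) (p ++ inj₂ b ∷ q)
  swap : (p q : Word m n) (a : Fin m) (b : Fin n) →
         Move (p ++ inj₁ a ∷ inj₂ b ∷ q) (p ++ inj₂ b ∷ inj₁ a ∷ q)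

BubStep : (m n : ℕ) → Word m n → Word m n → Set
BubStep m n u v = IsShuf m n u × IsShuf m n v × Move u v

BubLe : (m n : ℕ) → Word m n → Word m n → Set
BubLe m n = Star (BubStep m n)

InW : (m n : ℕ) → Word m n → Word m n → Word m n → Set
InW m n xs ys u = IsShuf m n u × restrict u (xWord m n) ≡ xs × restrict u (yWord m n) ≡ ys

W̃ : (m n : ℕ) → Word m n → Word m n → Set
W̃ m n xs ys = Σ (Word m n) (InW m n xs ys)

_≈W_ : ∀ {m n xs ys} → W̃ m n xs ys → W̃ m n xs ys → Set
u ≈W v = proj₁ u ≡ proj₁ v

_≤W_ : ∀ {m n xs ys} → W̃ m n xs ys → W̃ m n xs ys → Set
_≤W_ {m} {n} u v = BubLe m n (proj₁ u) (proj₁ v)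

-- An element u of W̃ is determined by its letters and its shape: the lattice path that takes an
-- up-step at each Y-letter and a right-step at each X-letter of u, so W̃ has as many elements as
-- there are paths with s right-steps and t up-steps, namely the interleavings of x^(s) and y^(t).
-- Deleting an X, inserting a Y and transposing xy into yx each raise the path pointwise; conversely,
-- a pointwise higher path with the same letters is reached by transpositions that bubble Y-letters
-- forward. Hence ≤bub on W̃ is the pointwise order of the height functions of the paths. The
-- pointwise maximum and minimum of two height functions are again height functions of paths, so
-- W̃ embeds as a sublattice of the distributive lattice ℕ → ℕ.
module Submission where

open import Defs
open import Data.Nat using (ℕ; zero; suc; pred; _+_; _≤_; _⊔_; _⊓_; z≤n)
open import Data.Nat.Properties
open import Data.Nat.Combinatorics using (_C_; nCn≡1; nCk+nC[k+1]≡[n+1]C[k+1])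
open import Data.Bool using (Bool; true; false)
open import Data.Fin using (Fin)
open import Data.Sum using (inj₁; inj₂; isInj₁; isInj₂; [_,_]′)
import Data.Sum.Properties as Sum
open import Data.List using (List; []; _∷_; _++_; map; mapMaybe; length; allFin)
open import Data.List.Properties
  using (mapMaybe-++; ∷-injective; ∷-injectiveʳ; map-injective; length-map; length-++; filter-accept; filter-reject)
open import Data.List.Relation.Unary.All using (All; []; _∷_)
open import Data.List.Relation.Unary.AllPairs using ([]; _∷_)
open import Data.List.Relation.Unary.Any using (here)
open import Data.List.Relation.Unary.Unique.Propositional using (Unique)
import Data.List.Relation.Unary.Unique.Propositional.Properties as Unique
open import Data.List.Relation.Binary.Sublist.Propositional using (_⊆_; []; _∷_; _∷ʳ_)
open import Data.List.Relation.Binary.Sublist.Propositional.Properties using (All-resp-⊆)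
open import Data.List.Membership.Propositional using (_∈_; _∉_)
open import Data.List.Membership.Propositional.Properties
  using (∈-map⁺; ∈-map⁻; ∈-allFin; ∈-++⁺ˡ; ∈-++⁺ʳ; ∈-++⁻)
open import Data.Product using (Σ; _×_; _,_; proj₁; proj₂; ∃)
open import Relation.Binary using (Rel; IsPreorder; _Preserves₂_⟶_⟶_)
open import Relation.Binary.PropositionalEquality
open import Relation.Binary.Construct.Closure.ReflexiveTransitive using (Star; ε; _◅_; _◅◅_; gmap)
open import Relation.Binary.Lattice.Structures using (IsDistributiveLattice)
open import Function using (_∘_)
open import Function.Bundles using (_⇔_; mk⇔)
open import Relation.Nullary using (¬_)

Unique-resp-⊆ : ∀ {A : Set} {xs ys : List A} → xs ⊆ ys → Unique ys → Unique xs
Unique-resp-⊆ []         []         = []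
Unique-resp-⊆ (_ ∷ʳ xs⊆) (_ ∷ u)    = Unique-resp-⊆ xs⊆ u
Unique-resp-⊆ (refl ∷ xs⊆) (a ∷ u)  = All-resp-⊆ xs⊆ a ∷ Unique-resp-⊆ xs⊆ u

sublist-of-map : ∀ {A B : Set} (f : A → B) (l : List A) {xs : List B} →
                 xs ⊆ map f l → ∃ λ as → xs ≡ map f as
sublist-of-map f []      []         = [] , refl
sublist-of-map f (a ∷ l) (_ ∷ʳ xs⊆) = sublist-of-map f l xs⊆
sublist-of-map f (a ∷ l) (refl ∷ xs⊆) with as , refl ← sublist-of-map f l xs⊆ = a ∷ as , refl

-- Lattice paths

rise : Bool → ℕ
rise false = 0
rise true  = 1

height : List Bool → ℕ → ℕ
height b       zero    = 0
height []      (suc i) = 0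
height (x ∷ b) (suc i) = rise x + height b i

height-[] : ∀ i → height [] i ≡ 0
height-[] zero    = refl
height-[] (suc i) = refl

ups : List Bool → ℕ
ups b = height b (length b)

rights : List Bool → ℕ
rights []          = 0
rights (false ∷ b) = suc (rights b)
rights (true ∷ b)  = rights b

length≡rights+ups : ∀ b → length b ≡ rights b + ups b
length≡rights+ups []          = refl
length≡rights+ups (false ∷ b) = cong suc (length≡rights+ups b)
length≡rights+ups (true ∷ b)  =
  trans (cong suc (length≡rights+ups b)) (sym (+-suc (rights b) (ups b)))

rise-injective : ∀ {x y} → rise x ≡ rise y → x ≡ y
rise-injective {false} {false} _ = refl
rise-injective {true}  {true}  _ = refl

height-injective : ∀ {b c} → length b ≡ length c → (∀ i → height b i ≡ height c i) → b ≡ c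
height-injective {[]}    {[]}    _   _ = refl
height-injective {x ∷ b} {y ∷ c} len h
  with refl ← rise-injective (trans (sym (+-identityʳ (rise x))) (trans (h 1) (+-identityʳ (rise y))))
  = cong (x ∷_) (height-injective (suc-injective len) (λ i → +-cancelˡ-≡ (rise x) _ _ (h (suc i))))

height-≤-suc : ∀ b i → height b i ≤ height b (suc i)
height-≤-suc b       zero    = z≤n
height-≤-suc []      (suc i) = z≤n
height-≤-suc (x ∷ b) (suc i) = +-monoʳ-≤ (rise x) (height-≤-suc b i)

height-suc-≤ : ∀ b i → height b (suc i) ≤ suc (height b i)
height-suc-≤ []          i       = z≤n
height-suc-≤ (false ∷ b) zero    = z≤n
height-suc-≤ (true ∷ b)  zero    = ≤-refl
height-suc-≤ (x ∷ b)     (suc i) =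
  ≤-trans (+-monoʳ-≤ (rise x) (height-suc-≤ b i)) (≤-reflexive (+-suc (rise x) _))

infix 4 _≼_

_≼_ : List Bool → List Bool → Set
b ≼ c = ∀ i → height b i ≤ height c i

≼-refl : ∀ {b} → b ≼ b
≼-refl i = ≤-refl

≼-trans : ∀ {b c d} → b ≼ c → c ≼ d → b ≼ d
≼-trans b≼c c≼d i = ≤-trans (b≼c i) (c≼d i)

∷⁺-≼ : ∀ x {b c} → b ≼ c → x ∷ b ≼ x ∷ c
∷⁺-≼ x b≼c zero    = z≤n
∷⁺-≼ x b≼c (suc i) = +-monoʳ-≤ (rise x) (b≼c i)

∷⁻-≼ : ∀ x {b c} → x ∷ b ≼ x ∷ c → b ≼ c
∷⁻-≼ x b≼c i = +-cancelˡ-≤ (rise x) _ _ (b≼c (suc i))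

false∷-≼ : ∀ b → false ∷ b ≼ b
false∷-≼ b zero    = z≤n
false∷-≼ b (suc i) = height-≤-suc b i

≼-true∷ : ∀ b → b ≼ true ∷ b
≼-true∷ b zero    = z≤n
≼-true∷ b (suc i) = height-suc-≤ b i

false∷true∷-≼ : ∀ b → false ∷ true ∷ b ≼ true ∷ false ∷ b
false∷true∷-≼ b zero          = z≤n
false∷true∷-≼ b (suc zero)    = z≤n
false∷true∷-≼ b (suc (suc i)) = ≤-refl

-- Pointwise combination of paths

UnitStep : (ℕ → ℕ → ℕ) → Set
UnitStep _∙_ = ∀ a b x y → ∃ λ z → (a + rise x) ∙ (b + rise y) ≡ a ∙ b + rise z

between⇒+rise : ∀ {k c} → k ≤ c → c ≤ suc k → ∃ λ z → c ≡ k + rise z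
between⇒+rise {k} k≤c c≤1+k with m≤n⇒m<n∨m≡n k≤c
... | inj₁ k<c  = true , trans (≤-antisym c≤1+k k<c) (+-comm 1 k)
... | inj₂ refl = false , sym (+-identityʳ k)

+rise-≤-suc : ∀ a x → a + rise x ≤ suc a
+rise-≤-suc a false = ≤-trans (≤-reflexive (+-identityʳ a)) (n≤1+n a)
+rise-≤-suc a true  = ≤-reflexive (+-comm a 1)

monotone⇒unitStep : ∀ {_∙_} → _∙_ Preserves₂ _≤_ ⟶ _≤_ ⟶ _≤_ →
                    (∀ a b → suc a ∙ suc b ≡ suc (a ∙ b)) → UnitStep _∙_
monotone⇒unitStep mono suc-∙ a b x y = between⇒+rise
  (mono (m≤m+n a (rise x)) (m≤m+n b (rise y)))
  (≤-trans (mono (+rise-≤-suc a x) (+rise-≤-suc b y)) (≤-reflexive (suc-∙ a b)))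

⊔-unitStep : UnitStep _⊔_
⊔-unitStep = monotone⇒unitStep ⊔-mono-≤ (λ _ _ → refl)

⊓-unitStep : UnitStep _⊓_
⊓-unitStep = monotone⇒unitStep ⊓-mono-≤ (λ _ _ → refl)

module Combine (_∙_ : ℕ → ℕ → ℕ) (unitStep : UnitStep _∙_) where

  -- Only meaningful for paths of equal length.
  combine : ℕ → ℕ → List Bool → List Bool → List Bool
  combine a b (x ∷ u) (y ∷ v) = proj₁ (unitStep a b x y) ∷ combine (a + rise x) (b + rise y) u v
  combine a b _       _       = []

  length-combine : ∀ a b {u v} → length u ≡ length v → length (combine a b u v) ≡ length u
  length-combine a b {[]}    {[]}    _   = refl
  length-combine a b {x ∷ u} {y ∷ v} len = cong suc (length-combine _ _ {u} {v} (suc-injective len))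

  +0-∙ : ∀ a b → a ∙ b + 0 ≡ (a + 0) ∙ (b + 0)
  +0-∙ a b = trans (+-identityʳ _) (sym (cong₂ _∙_ (+-identityʳ a) (+-identityʳ b)))

  height-combine : ∀ a b {u v} → length u ≡ length v → ∀ i →
                   a ∙ b + height (combine a b u v) i ≡ (a + height u i) ∙ (b + height v i)
  height-combine a b {[]}    {[]}    _ i rewrite height-[] i = +0-∙ a b
  height-combine a b {x ∷ u} {y ∷ v} _ zero = +0-∙ a b
  height-combine a b {x ∷ u} {y ∷ v} len (suc i) = begin
    a ∙ b + (rise z + height w i)                             ≡⟨ +-assoc (a ∙ b) (rise z) _ ⟨
    a ∙ b + rise z + height w i                               ≡⟨ cong (_+ height w i) (proj₂ (unitStep a b x y)) ⟨
    (a + rise x) ∙ (b + rise y) + height w i                  ≡⟨ height-combine _ _ {u} {v} (suc-injective len) i ⟩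
    (a + rise x + height u i) ∙ (b + rise y + height v i)     ≡⟨ cong₂ _∙_ (+-assoc a _ _) (+-assoc b _ _) ⟩
    (a + (rise x + height u i)) ∙ (b + (rise y + height v i)) ∎
    where
      open ≡-Reasoning
      z = proj₁ (unitStep a b x y)
      w = combine (a + rise x) (b + rise y) u v
  height-combine a b {[]}    {_ ∷ _} ()
  height-combine a b {_ ∷ _} {[]}    ()

  height-combine₀ : 0 ∙ 0 ≡ 0 → ∀ {u v} → length u ≡ length v → ∀ i →
                    height (combine 0 0 u v) i ≡ height u i ∙ height v i
  height-combine₀ 0∙0≡0 {u} {v} len i =
    trans (cong (_+ height (combine 0 0 u v) i) (sym 0∙0≡0)) (height-combine 0 0 len i)

-- Distributive lattices embedded in ℕ → ℕ

module _ {a ℓ₁ ℓ₂} {A : Set a} {_≈_ : Rel A ℓ₁} {_⊑_ : Rel A ℓ₂}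
         (isPreorder : IsPreorder _≈_ _⊑_)
         (h : A → ℕ → ℕ)
         (h-injective : ∀ {u v} → (∀ i → h u i ≡ h v i) → u ≈ v)
         (≤⇒h≤ : ∀ {u v} → u ⊑ v → ∀ i → h u i ≤ h v i)
         (h≤⇒≤ : ∀ {u v} → (∀ i → h u i ≤ h v i) → u ⊑ v)
         (_∨_ _∧_ : A → A → A)
         (h-∨ : ∀ u v i → h (u ∨ v) i ≡ h u i ⊔ h v i)
         (h-∧ : ∀ u v i → h (u ∧ v) i ≡ h u i ⊓ h v i)
         where

  pointwise-isDistributiveLattice : IsDistributiveLattice _≈_ _⊑_ _∨_ _∧_
  pointwise-isDistributiveLattice = record
    { isLattice = record
      { isPartialOrder = record
        { isPreorder = isPreorder
        ; antisym    = λ u≤v v≤u → h-injective λ i → ≤-antisym (≤⇒h≤ u≤v i) (≤⇒h≤ v≤u i)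
        }
      ; supremum = λ u v →
          h≤⇒≤ (λ i → ≤-trans (m≤m⊔n _ _) (≤-reflexive (sym (h-∨ u v i)))) ,
          h≤⇒≤ (λ i → ≤-trans (m≤n⊔m _ _) (≤-reflexive (sym (h-∨ u v i)))) ,
          λ w u≤w v≤w → h≤⇒≤ λ i →
            ≤-trans (≤-reflexive (h-∨ u v i)) (⊔-lub (≤⇒h≤ u≤w i) (≤⇒h≤ v≤w i))
      ; infimum = λ u v →
          h≤⇒≤ (λ i → ≤-trans (≤-reflexive (h-∧ u v i)) (m⊓n≤m _ _)) ,
          h≤⇒≤ (λ i → ≤-trans (≤-reflexive (h-∧ u v i)) (m⊓n≤n _ _)) ,
          λ w w≤u w≤v → h≤⇒≤ λ i →
            ≤-trans (⊓-glb (≤⇒h≤ w≤u i) (≤⇒h≤ w≤v i)) (≤-reflexive (sym (h-∧ u v i)))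
      }
    ; ∧-distribˡ-∨ = λ u v w → h-injective λ i → begin
        h (u ∧ (v ∨ w)) i                 ≡⟨ h-∧ u (v ∨ w) i ⟩
        h u i ⊓ h (v ∨ w) i               ≡⟨ cong (h u i ⊓_) (h-∨ v w i) ⟩
        h u i ⊓ (h v i ⊔ h w i)           ≡⟨ ⊓-distribˡ-⊔ (h u i) (h v i) (h w i) ⟩
        h u i ⊓ h v i ⊔ h u i ⊓ h w i     ≡⟨ cong₂ _⊔_ (h-∧ u v i) (h-∧ u w i) ⟨
        h (u ∧ v) i ⊔ h (u ∧ w) i         ≡⟨ h-∨ (u ∧ v) (u ∧ w) i ⟨
        h ((u ∧ v) ∨ (u ∧ w)) i           ∎
    }
    where open ≡-Reasoning

-- Words as interleavings of their X- and Y-letters along a path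

module _ {m n : ℕ} where
  open import Data.List.Membership.DecPropositional (_≟L_ {m} {n}) using (_∈?_)

  xLetters : Word m n → List (Fin m)
  xLetters = mapMaybe isInj₁

  yLetters : Word m n → List (Fin n)
  yLetters = mapMaybe isInj₂

  isY : Letter m n → Bool
  isY (inj₁ _) = false
  isY (inj₂ _) = true

  shape : Word m n → List Bool
  shape = map isY

  HasLetters : List (Fin m) → List (Fin n) → Word m n → Set
  HasLetters as bs w = xLetters w ≡ as × yLetters w ≡ bs

  restrict-xWord : ∀ u → restrict u (xWord m n) ≡ map inj₁ (xLetters u)
  restrict-xWord []           = refl
  restrict-xWord (inj₁ a ∷ u) = trans (filter-accept (_∈? xWord m n) (∈-map⁺ inj₁ (∈-allFin a)))
                                      (cong (inj₁ a ∷_) (restrict-xWord u))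
  restrict-xWord (inj₂ b ∷ u) = trans (filter-reject (_∈? xWord m n) inj₂∉) (restrict-xWord u)
    where inj₂∉ : inj₂ b ∉ xWord m n
          inj₂∉ b∈ with _ , _ , () ← ∈-map⁻ inj₁ b∈

  restrict-yWord : ∀ u → restrict u (yWord m n) ≡ map inj₂ (yLetters u)
  restrict-yWord []           = refl
  restrict-yWord (inj₁ a ∷ u) = trans (filter-reject (_∈? yWord m n) inj₁∉) (restrict-yWord u)
    where inj₁∉ : inj₁ a ∉ yWord m n
          inj₁∉ a∈ with _ , _ , () ← ∈-map⁻ inj₂ a∈
  restrict-yWord (inj₂ b ∷ u) = trans (filter-accept (_∈? yWord m n) (∈-map⁺ inj₂ (∈-allFin b)))
                                      (cong (inj₂ b ∷_) (restrict-yWord u))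

  All≢-inj₁ : ∀ a u → All (a ≢_) (xLetters u) → All (inj₁ a ≢_) u
  All≢-inj₁ a []           []         = []
  All≢-inj₁ a (inj₁ c ∷ u) (a≢c ∷ ps) = (λ e → a≢c (Sum.inj₁-injective e)) ∷ All≢-inj₁ a u ps
  All≢-inj₁ a (inj₂ c ∷ u) ps         = (λ ()) ∷ All≢-inj₁ a u ps

  All≢-inj₂ : ∀ b u → All (b ≢_) (yLetters u) → All (inj₂ b ≢_) u
  All≢-inj₂ b []           []         = []
  All≢-inj₂ b (inj₁ c ∷ u) ps         = (λ ()) ∷ All≢-inj₂ b u ps
  All≢-inj₂ b (inj₂ c ∷ u) (b≢c ∷ ps) = (λ e → b≢c (Sum.inj₂-injective e)) ∷ All≢-inj₂ b u ps

  unique-fromLetters : ∀ u → Unique (xLetters u) → Unique (yLetters u) → Unique u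
  unique-fromLetters []           _          _          = []
  unique-fromLetters (inj₁ a ∷ u) (a∉ ∷ ux) uy         = All≢-inj₁ a u a∉ ∷ unique-fromLetters u ux uy
  unique-fromLetters (inj₂ b ∷ u) ux         (b∉ ∷ uy) = All≢-inj₂ b u b∉ ∷ unique-fromLetters u ux uy

  merge : List Bool → List (Fin m) → List (Fin n) → Word m n
  merge (false ∷ b) (a ∷ as) bs       = inj₁ a ∷ merge b as bs
  merge (true ∷ b)  as       (c ∷ bs) = inj₂ c ∷ merge b as bs
  merge _           _        _        = []

  merge-shape : ∀ u → merge (shape u) (xLetters u) (yLetters u) ≡ u
  merge-shape []           = refl
  merge-shape (inj₁ a ∷ u) = cong (inj₁ a ∷_) (merge-shape u)
  merge-shape (inj₂ b ∷ u) = cong (inj₂ b ∷_) (merge-shape u)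

  merge-inverse : ∀ b {as bs} → rights b ≡ length as → ups b ≡ length bs →
                  HasLetters as bs (merge b as bs) × shape (merge b as bs) ≡ b
  merge-inverse []          {[]}     {[]}     _ _ = (refl , refl) , refl
  merge-inverse (false ∷ b) {a ∷ as} r≡ u≡
    with (ex , ey) , es ← merge-inverse b (suc-injective r≡) u≡
    = (cong (a ∷_) ex , ey) , cong (false ∷_) es
  merge-inverse (true ∷ b)  {bs = c ∷ bs} r≡ u≡
    with (ex , ey) , es ← merge-inverse b r≡ (suc-injective u≡)
    = (ex , cong (c ∷_) ey) , cong (true ∷_) es
  merge-inverse []          {_ ∷ _}       ()
  merge-inverse []          {[]} {_ ∷ _}  _  ()
  merge-inverse (false ∷ b) {[]}          ()
  merge-inverse (true ∷ b)  {bs = []}     _  ()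

  letters-shape-injective : ∀ {u v} → xLetters u ≡ xLetters v → yLetters u ≡ yLetters v →
                            shape u ≡ shape v → u ≡ v
  letters-shape-injective {u} {v} ex ey es = begin
    u                                         ≡⟨ merge-shape u ⟨
    merge (shape u) (xLetters u) (yLetters u) ≡⟨ cong₂ (merge (shape u)) ex ey ⟩
    merge (shape u) (xLetters v) (yLetters v) ≡⟨ cong (λ b → merge b (xLetters v) (yLetters v)) es ⟩
    merge (shape v) (xLetters v) (yLetters v) ≡⟨ merge-shape v ⟩
    v                                         ∎
    where open ≡-Reasoning

  rights-shape : ∀ u → rights (shape u) ≡ length (xLetters u)
  rights-shape []           = refl
  rights-shape (inj₁ a ∷ u) = cong suc (rights-shape u)
  rights-shape (inj₂ b ∷ u) = rights-shape u

  ups-shape : ∀ u → ups (shape u) ≡ length (yLetters u)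
  ups-shape []           = refl
  ups-shape (inj₁ a ∷ u) = ups-shape u
  ups-shape (inj₂ b ∷ u) = cong suc (ups-shape u)

  shape-++⁺-≼ : ∀ p {u v : Word m n} → shape u ≼ shape v → shape (p ++ u) ≼ shape (p ++ v)
  shape-++⁺-≼ []      u≼v = u≼v
  shape-++⁺-≼ (x ∷ p) u≼v = ∷⁺-≼ (isY x) (shape-++⁺-≼ p u≼v)

  move⇒shape-≼ : ∀ {u v : Word m n} → Move u v → shape u ≼ shape v
  move⇒shape-≼ (delX p q a)   = shape-++⁺-≼ p (false∷-≼ (shape q))
  move⇒shape-≼ (insY p q b)   = shape-++⁺-≼ p (≼-true∷ (shape q))
  move⇒shape-≼ (swap p q a b) = shape-++⁺-≼ p (false∷true∷-≼ (shape q))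

  bubLe⇒shape-≼ : ∀ {u v : Word m n} → BubLe m n u v → shape u ≼ shape v
  bubLe⇒shape-≼ ε                   = ≼-refl
  bubLe⇒shape-≼ ((_ , _ , mv) ◅ u≤v) = ≼-trans (move⇒shape-≼ mv) (bubLe⇒shape-≼ u≤v)

  data Transposition : Word m n → Word m n → Set where
    transpose : ∀ p q a b → Transposition (p ++ inj₁ a ∷ inj₂ b ∷ q) (p ++ inj₂ b ∷ inj₁ a ∷ q)

  transposition⇒move : ∀ {u v} → Transposition u v → Move u v
  transposition⇒move (transpose p q a b) = swap p q a b

  transposition-xLetters : ∀ {u v} → Transposition u v → xLetters u ≡ xLetters v
  transposition-xLetters (transpose p q a b) =
    trans (mapMaybe-++ isInj₁ p _) (sym (mapMaybe-++ isInj₁ p _))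

  transposition-yLetters : ∀ {u v} → Transposition u v → yLetters u ≡ yLetters v
  transposition-yLetters (transpose p q a b) =
    trans (mapMaybe-++ isInj₂ p _) (sym (mapMaybe-++ isInj₂ p _))

  ∷-transpositions : ∀ c {u v} → Star Transposition u v → Star Transposition (c ∷ u) (c ∷ v)
  ∷-transpositions c = gmap (c ∷_) λ { (transpose p q a b) → transpose (c ∷ p) q a b }

  -- Moving the first Y of u to the front lowers the rest of the path by one step.
  bubble-firstY : ∀ u {b bs} → yLetters u ≡ b ∷ bs →
    Σ (Word m n) λ w → Star Transposition u (inj₂ b ∷ w) ×
      xLetters w ≡ xLetters u × yLetters w ≡ bs × (∀ i → height (shape w) i ≤ pred (height (shape u) (suc i)))
  bubble-firstY (inj₂ c ∷ u) refl = u , ε , refl , refl , λ i → ≤-refl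
  bubble-firstY (inj₁ a ∷ u) {b} yu≡
    with w , u↝bw , ex , ey , below ← bubble-firstY u yu≡
    = inj₁ a ∷ w , ∷-transpositions (inj₁ a) u↝bw ◅◅ (transpose [] w a b ◅ ε) , cong (a ∷_) ex , ey ,
      λ { zero → z≤n ; (suc i) → below i }

  shape-≼⇒transpositions : ∀ u v → xLetters u ≡ xLetters v → yLetters u ≡ yLetters v →
                           shape u ≼ shape v → Star Transposition u v
  shape-≼⇒transpositions []           []           _  _  _ = ε
  shape-≼⇒transpositions (inj₁ a ∷ u) (inj₁ _ ∷ v) ex ey u≼v
    with refl , ex′ ← ∷-injective ex
    = ∷-transpositions (inj₁ a) (shape-≼⇒transpositions u v ex′ ey (∷⁻-≼ false u≼v))
  shape-≼⇒transpositions (inj₂ b ∷ u) (inj₂ _ ∷ v) ex ey u≼v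
    with refl , ey′ ← ∷-injective ey
    = ∷-transpositions (inj₂ b) (shape-≼⇒transpositions u v ex ey′ (∷⁻-≼ true u≼v))
  shape-≼⇒transpositions (inj₂ b ∷ u) (inj₁ a ∷ v) _ _ u≼v with () ← u≼v 1
  shape-≼⇒transpositions (inj₁ a ∷ u) (inj₂ b ∷ v) ex ey u≼v
    with w , u↝bw , ex′ , ey′ , below ← bubble-firstY (inj₁ a ∷ u) ey
    = u↝bw ◅◅ ∷-transpositions (inj₂ b)
        (shape-≼⇒transpositions w v (trans ex′ ex) ey′ λ i → ≤-trans (below i) (pred-mono-≤ (u≼v (suc i))))
  shape-≼⇒transpositions []           (inj₁ _ ∷ _) () _
  shape-≼⇒transpositions []           (inj₂ _ ∷ _) _  ()
  shape-≼⇒transpositions (inj₁ _ ∷ _) []           () _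
  shape-≼⇒transpositions (inj₂ _ ∷ _) []           _  ()

  transpositions⇒bubLe : ∀ {as bs} → (∀ {w} → HasLetters as bs w → IsShuf m n w) →
                         ∀ {u v} → Star Transposition u v → HasLetters as bs u → BubLe m n u v
  transpositions⇒bubLe isShuf ε _ = ε
  transpositions⇒bubLe isShuf (t ◅ ts) (ex , ey) =
    (isShuf (ex , ey) , isShuf letters′ , transposition⇒move t) ◅ transpositions⇒bubLe isShuf ts letters′
    where letters′ = trans (sym (transposition-xLetters t)) ex , trans (sym (transposition-yLetters t)) ey

  interleavings : List (Fin m) → List (Fin n) → List (Word m n)
  interleavings []       []       = [] ∷ []
  interleavings (a ∷ as) []       = map (inj₁ a ∷_) (interleavings as [])
  interleavings []       (b ∷ bs) = map (inj₂ b ∷_) (interleavings [] bs)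
  interleavings (a ∷ as) (b ∷ bs) =
    map (inj₁ a ∷_) (interleavings as (b ∷ bs)) ++ map (inj₂ b ∷_) (interleavings (a ∷ as) bs)

  inj₁∷-∈-interleavings : ∀ a as bs {w} → w ∈ interleavings as bs → inj₁ a ∷ w ∈ interleavings (a ∷ as) bs
  inj₁∷-∈-interleavings a as []       w∈ = ∈-map⁺ (inj₁ a ∷_) w∈
  inj₁∷-∈-interleavings a as (b ∷ bs) w∈ = ∈-++⁺ˡ (∈-map⁺ (inj₁ a ∷_) w∈)

  inj₂∷-∈-interleavings : ∀ b as bs {w} → w ∈ interleavings as bs → inj₂ b ∷ w ∈ interleavings as (b ∷ bs)
  inj₂∷-∈-interleavings b []       bs w∈ = ∈-map⁺ (inj₂ b ∷_) w∈
  inj₂∷-∈-interleavings b (a ∷ as) bs w∈ = ∈-++⁺ʳ _ (∈-map⁺ (inj₂ b ∷_) w∈)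

  ∈-interleavings⁺ : ∀ {as bs u} → HasLetters as bs u → u ∈ interleavings as bs
  ∈-interleavings⁺ {u = []}         (refl , refl) = here refl
  ∈-interleavings⁺ {u = inj₁ a ∷ u} (refl , refl) = inj₁∷-∈-interleavings a (xLetters u) (yLetters u) (∈-interleavings⁺ (refl , refl))
  ∈-interleavings⁺ {u = inj₂ b ∷ u} (refl , refl) = inj₂∷-∈-interleavings b (xLetters u) (yLetters u) (∈-interleavings⁺ (refl , refl))

  ∈-map-inj₁∷⁻ : ∀ a {as bs u} → u ∈ map (inj₁ a ∷_) (interleavings as bs) →
                 (∀ {w} → w ∈ interleavings as bs → HasLetters as bs w) → HasLetters (a ∷ as) bs u
  ∈-map-inj₁∷⁻ a u∈ ih with _ , w∈ , refl ← ∈-map⁻ (inj₁ a ∷_) u∈ with ex , ey ← ih w∈ = cong (a ∷_) ex , ey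

  ∈-map-inj₂∷⁻ : ∀ b {as bs u} → u ∈ map (inj₂ b ∷_) (interleavings as bs) →
                 (∀ {w} → w ∈ interleavings as bs → HasLetters as bs w) → HasLetters as (b ∷ bs) u
  ∈-map-inj₂∷⁻ b u∈ ih with _ , w∈ , refl ← ∈-map⁻ (inj₂ b ∷_) u∈ with ex , ey ← ih w∈ = ex , cong (b ∷_) ey

  ∈-interleavings⁻ : ∀ as bs {u} → u ∈ interleavings as bs → HasLetters as bs u
  ∈-interleavings⁻ []       []       (here refl) = refl , refl
  ∈-interleavings⁻ (a ∷ as) []       u∈          = ∈-map-inj₁∷⁻ a u∈ (∈-interleavings⁻ as [])
  ∈-interleavings⁻ []       (b ∷ bs) u∈          = ∈-map-inj₂∷⁻ b u∈ (∈-interleavings⁻ [] bs)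
  ∈-interleavings⁻ (a ∷ as) (b ∷ bs) u∈ =
    [ (λ u∈ˡ → ∈-map-inj₁∷⁻ a u∈ˡ (∈-interleavings⁻ as (b ∷ bs)))
    , (λ u∈ʳ → ∈-map-inj₂∷⁻ b u∈ʳ (∈-interleavings⁻ (a ∷ as) bs))
    ]′ (∈-++⁻ (map (inj₁ a ∷_) (interleavings as (b ∷ bs))) u∈)

  interleavings-unique : ∀ as bs → Unique (interleavings as bs)
  interleavings-unique []       []       = [] ∷ []
  interleavings-unique (a ∷ as) []       = Unique.map⁺ ∷-injectiveʳ (interleavings-unique as [])
  interleavings-unique []       (b ∷ bs) = Unique.map⁺ ∷-injectiveʳ (interleavings-unique [] bs)
  interleavings-unique (a ∷ as) (b ∷ bs) =
    Unique.++⁺ (Unique.map⁺ ∷-injectiveʳ (interleavings-unique as (b ∷ bs)))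
               (Unique.map⁺ ∷-injectiveʳ (interleavings-unique (a ∷ as) bs))
               disjoint
    where
      disjoint : ∀ {u} → ¬ (u ∈ map (inj₁ a ∷_) (interleavings as (b ∷ bs)) ×
                            u ∈ map (inj₂ b ∷_) (interleavings (a ∷ as) bs))
      disjoint (u∈ˡ , u∈ʳ) with _ , _ , refl ← ∈-map⁻ (inj₁ a ∷_) u∈ˡ | _ , _ , () ← ∈-map⁻ (inj₂ b ∷_) u∈ʳ

  length-interleavings : ∀ as bs → length (interleavings as bs) ≡ (length as + length bs) C length as
  length-interleavings []       []       = refl
  length-interleavings (a ∷ as) []       = begin
    length (map (inj₁ a ∷_) (interleavings as []))  ≡⟨ length-map _ (interleavings as []) ⟩
    length (interleavings as [])                     ≡⟨ length-interleavings as [] ⟩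
    (length as + 0) C length as                      ≡⟨ cong (_C length as) (+-identityʳ (length as)) ⟩
    length as C length as                            ≡⟨ nCn≡1 (length as) ⟩
    1                                                ≡⟨ nCn≡1 (suc (length as)) ⟨
    suc (length as) C suc (length as)                ≡⟨ cong (_C suc (length as)) (+-identityʳ (suc (length as))) ⟨
    (suc (length as) + 0) C suc (length as)          ∎
    where open ≡-Reasoning
  length-interleavings []       (b ∷ bs) = trans (length-map _ (interleavings [] bs)) (length-interleavings [] bs)
  length-interleavings (a ∷ as) (b ∷ bs) = begin
    length (map (inj₁ a ∷_) xFirst ++ map (inj₂ b ∷_) yFirst)  ≡⟨ length-++ (map (inj₁ a ∷_) xFirst) ⟩
    length (map (inj₁ a ∷_) xFirst) + length (map (inj₂ b ∷_) yFirst)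
      ≡⟨ cong₂ _+_ (length-map _ xFirst) (length-map _ yFirst) ⟩
    length xFirst + length yFirst
      ≡⟨ cong₂ _+_ (length-interleavings as (b ∷ bs)) (length-interleavings (a ∷ as) bs) ⟩
    (k + suc l) C k + (suc k + l) C suc k
      ≡⟨ cong (λ n → (k + suc l) C k + n C suc k) (+-suc k l) ⟨
    (k + suc l) C k + (k + suc l) C suc k                      ≡⟨ nCk+nC[k+1]≡[n+1]C[k+1] (k + suc l) k ⟩
    suc (k + suc l) C suc k                                    ∎
    where open ≡-Reasoning
          xFirst = interleavings as (b ∷ bs)
          yFirst = interleavings (a ∷ as) bs
          k = length as
          l = length bs

-- W̃ as a lattice of paths

module FixedLetters {m n : ℕ} (as : List (Fin m)) (bs : List (Fin n))
                    (as⊆x : map inj₁ as ⊆ xWord m n) (bs⊆y : map inj₂ bs ⊆ yWord m n) where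

  Xs Ys : Word m n
  Xs = map inj₁ as
  Ys = map inj₂ bs

  W : Set
  W = W̃ m n Xs Ys

  _≈ʷ_ _≤ʷ_ : W → W → Set
  _≈ʷ_ = _≈W_ {m} {n} {Xs} {Ys}
  _≤ʷ_ = _≤W_ {m} {n} {Xs} {Ys}

  hasLetters⇒isShuf : ∀ {w} → HasLetters as bs w → IsShuf m n w
  hasLetters⇒isShuf {w} (refl , refl) =
    unique-fromLetters w (Unique.map⁻ (Unique-resp-⊆ as⊆x xWord-unique))
                         (Unique.map⁻ (Unique-resp-⊆ bs⊆y yWord-unique)) ,
    subst (_⊆ xWord m n) (sym (restrict-xWord w)) as⊆x ,
    subst (_⊆ yWord m n) (sym (restrict-yWord w)) bs⊆y
    where xWord-unique = Unique.map⁺ Sum.inj₁-injective (Unique.allFin⁺ m)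
          yWord-unique = Unique.map⁺ Sum.inj₂-injective (Unique.allFin⁺ n)

  hasLetters⇒inW : ∀ {w} → HasLetters as bs w → InW m n Xs Ys w
  hasLetters⇒inW {w} (ex , ey) =
    hasLetters⇒isShuf (ex , ey) ,
    trans (restrict-xWord w) (cong (map inj₁) ex) ,
    trans (restrict-yWord w) (cong (map inj₂) ey)

  inW⇒hasLetters : ∀ {w} → InW m n Xs Ys w → HasLetters as bs w
  inW⇒hasLetters {w} (_ , rx , ry) =
    map-injective Sum.inj₁-injective (trans (sym (restrict-xWord w)) rx) ,
    map-injective Sum.inj₂-injective (trans (sym (restrict-yWord w)) ry)

  letters : (u : W) → HasLetters as bs (proj₁ u)
  letters (_ , u∈) = inW⇒hasLetters u∈

  path : W → List Bool
  path (u , _) = shape u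

  length-path : ∀ u → length (path u) ≡ length as + length bs
  length-path u@(w , _) with ex , ey ← letters u = begin
    length (shape w)                          ≡⟨ length≡rights+ups (shape w) ⟩
    rights (shape w) + ups (shape w)          ≡⟨ cong₂ _+_ (rights-shape w) (ups-shape w) ⟩
    length (xLetters w) + length (yLetters w) ≡⟨ cong₂ _+_ (cong length ex) (cong length ey) ⟩
    length as + length bs                     ∎
    where open ≡-Reasoning

  ups-path : ∀ u → ups (path u) ≡ length bs
  ups-path u@(w , _) = trans (ups-shape w) (cong length (proj₂ (letters u)))

  path-injective : ∀ {u v} → (∀ i → height (path u) i ≡ height (path v) i) → u ≈ʷ v
  path-injective {u} {v} same-heights
    with exu , eyu ← letters u | exv , eyv ← letters v
    = letters-shape-injective (trans exu (sym exv)) (trans eyu (sym eyv))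
        (height-injective (trans (length-path u) (sym (length-path v))) same-heights)

  ≤ʷ⇒path-≼ : ∀ {u v} → u ≤ʷ v → path u ≼ path v
  ≤ʷ⇒path-≼ = bubLe⇒shape-≼

  path-≼⇒≤ʷ : ∀ {u v} → path u ≼ path v → u ≤ʷ v
  path-≼⇒≤ʷ {u} {v} u≼v
    with exu , eyu ← letters u | exv , eyv ← letters v
    = transpositions⇒bubLe hasLetters⇒isShuf
        (shape-≼⇒transpositions _ _ (trans exu (sym exv)) (trans eyu (sym eyv)) u≼v) (exu , eyu)

  fromPath : (c : List Bool) → rights c ≡ length as → ups c ≡ length bs → W
  fromPath c r≡ u≡ = merge c as bs , hasLetters⇒inW (proj₁ (merge-inverse c r≡ u≡))

  path-fromPath : ∀ c r≡ u≡ → path (fromPath c r≡ u≡) ≡ c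
  path-fromPath c r≡ u≡ = proj₂ (merge-inverse c r≡ u≡)

  module Lift (_∙_ : ℕ → ℕ → ℕ) (unitStep : UnitStep _∙_) (idem : ∀ k → k ∙ k ≡ k) where
    open Combine _∙_ unitStep

    combined : W → W → List Bool
    combined u v = combine 0 0 (path u) (path v)

    same-length : ∀ u v → length (path u) ≡ length (path v)
    same-length u v = trans (length-path u) (sym (length-path v))

    height-combined : ∀ u v i → height (combined u v) i ≡ height (path u) i ∙ height (path v) i
    height-combined u v = height-combine₀ (idem 0) (same-length u v)

    length-combined : ∀ u v → length (combined u v) ≡ length (path u)
    length-combined u v = length-combine 0 0 {path u} {path v} (same-length u v)

    ups-combined : ∀ u v → ups (combined u v) ≡ length bs
    ups-combined u v = begin
      height (combined u v) (length (combined u v))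
        ≡⟨ height-combined u v (length (combined u v)) ⟩
      height (path u) (length (combined u v)) ∙ height (path v) (length (combined u v))
        ≡⟨ cong₂ _∙_ (cong (height (path u)) (length-combined u v))
                     (cong (height (path v)) (trans (length-combined u v) (same-length u v))) ⟩
      ups (path u) ∙ ups (path v)   ≡⟨ cong₂ _∙_ (ups-path u) (ups-path v) ⟩
      length bs ∙ length bs         ≡⟨ idem (length bs) ⟩
      length bs                     ∎
      where open ≡-Reasoning

    rights-combined : ∀ u v → rights (combined u v) ≡ length as
    rights-combined u v = +-cancelʳ-≡ _ _ (length as) (begin
      rights (combined u v) + length bs          ≡⟨ cong (rights (combined u v) +_) (ups-combined u v) ⟨
      rights (combined u v) + ups (combined u v) ≡⟨ length≡rights+ups (combined u v) ⟨
      length (combined u v)                      ≡⟨ trans (length-combined u v) (length-path u) ⟩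
      length as + length bs                      ∎)
      where open ≡-Reasoning

    _◇_ : W → W → W
    u ◇ v = fromPath (combined u v) (rights-combined u v) (ups-combined u v)

    height-◇ : ∀ u v i → height (path (u ◇ v)) i ≡ height (path u) i ∙ height (path v) i
    height-◇ u v i = trans (cong (λ c → height c i) (path-fromPath (combined u v) (rights-combined u v) (ups-combined u v))) (height-combined u v i)

  open Lift _⊔_ ⊔-unitStep ⊔-idem using () renaming (_◇_ to _∨_; height-◇ to height-∨)
  open Lift _⊓_ ⊓-unitStep ⊓-idem using () renaming (_◇_ to _∧_; height-◇ to height-∧)

  ≤ʷ-isPreorder : IsPreorder _≈ʷ_ _≤ʷ_
  ≤ʷ-isPreorder = record
    { isEquivalence = record { refl = refl ; sym = sym ; trans = trans }
    ; reflexive     = λ {u} u≈v → subst (BubLe m n (proj₁ u)) u≈v ε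
    ; trans         = _◅◅_
    }

  distributiveLattice : Σ (W → W → W) λ join → Σ (W → W → W) λ meet →
                        IsDistributiveLattice _≈ʷ_ _≤ʷ_ join meet
  distributiveLattice = _∨_ , _∧_ ,
    pointwise-isDistributiveLattice ≤ʷ-isPreorder (λ u → height (path u))
      (λ {u} {v} → path-injective {u} {v}) (λ {u} {v} → ≤ʷ⇒path-≼ {u} {v}) (λ {u} {v} → path-≼⇒≤ʷ {u} {v})
      _∨_ _∧_ height-∨ height-∧

  enumeration : Σ (List (Word m n)) λ L → Unique L ×
                length L ≡ (length Xs + length Ys) C length Xs × ((u : Word m n) → (u ∈ L ⇔ InW m n Xs Ys u))
  enumeration = interleavings as bs , interleavings-unique as bs ,
    trans (length-interleavings as bs)
          (sym (cong₂ (λ k l → (k + l) C k) (length-map inj₁ as) (length-map inj₂ bs))) ,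
    λ u → mk⇔ (hasLetters⇒inW ∘ ∈-interleavings⁻ as bs) (∈-interleavings⁺ ∘ inW⇒hasLetters)

proposition3p8 : (m n s t : ℕ) → 1 ≤ s → s ≤ m → 1 ≤ t → t ≤ n →
    (xs ys : Word m n) → xs ⊆ xWord m n → length xs ≡ s → ys ⊆ yWord m n → length ys ≡ t →
    (Σ (W̃ m n xs ys → W̃ m n xs ys → W̃ m n xs ys) λ join →
      Σ (W̃ m n xs ys → W̃ m n xs ys → W̃ m n xs ys) λ meet →
        IsDistributiveLattice (_≈W_ {m} {n} {xs} {ys}) (_≤W_ {m} {n} {xs} {ys}) join meet)
    × (Σ (List (Word m n)) λ L →
        Unique L × length L ≡ (s + t) C s × ((u : Word m n) → (u ∈ L ⇔ InW m n xs ys u)))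
proposition3p8 m n _ _ _ _ _ _ xs ys xs⊆x refl ys⊆y refl
  with as , refl ← sublist-of-map inj₁ (allFin m) xs⊆x
     | bs , refl ← sublist-of-map inj₂ (allFin n) ys⊆y
  = distributiveLattice , enumeration
  where open FixedLetters as bs xs⊆x ys⊆y
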